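{- Let $G=(V,E)$ be a source graph, $s>1$, $H_j\in\mathcal{H}_s$, and $v\in V$. If $f(H_i\mid G)(v)<\mathbf{W}_{r,s}(i,j)$ for some $H_i\in\mathcal{H}_r$ with $r<s$, then $f(H_j\mid G)(v)=0$. (The thresholds $\mathbf{W}_{r,s}(i,j)$ are independent of the source graph.)
   Context: All graphs are finite, undirected and simple. For a connected graph $H$, the automorphism group partitions $V(H)$ into orbits. A graphlet $H_\sigma$ is a connected graph $H$ (up to isomorphism) with one designated orbit $\sigma$; $\mathcal{H}_s$ is the finite set of all graphlets with $s$ nodes (identified up to isomorphisms preserving the designated orbit). For a graph $G$, $v\in V(G)$ and graphlet $H_\sigma$, the net count $f(H_\sigma\mid G)(v)$ is the number of distinct induced subgraphs $H'$ of $G$ isomorphic to $H$ via an isomorphism under which $v$ lies in the orbit of $H'$ corresponding to $\sigma$. $\mathbf{W}_{r,s}$ is the matrix indexed by $\mathcal{H}_r\times\mathcal{H}_s$ with $\mathbf{W}_{r,s}(i,j)=f(H_i\mid H_j)(v')$, where $v'$ is in the designated orbit of $H_j$ (regarding $H_j$ as a source graph). -}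

module Defs where

open import Data.Nat using (ℕ; zero; suc)
open import Data.Bool using (Bool; true; false; _∧_; _∨_; not)
import Data.Bool as B
open import Data.Fin using (Fin)
import Data.Fin as F
open import Data.Vec using (Vec; []; _∷_; lookup)
open import Data.List using (List; []; _∷_; [_]; map; concatMap; allFin; filter; length)
open import Data.Bool.ListAction using (all; any)
open import Relation.Nullary using (does)
open import Relation.Binary.PropositionalEquality using (_≡_)

record Graph (n : ℕ) : Set where
  field
    adj   : Fin n → Fin n → Bool
    sym   : ∀ i j → adj i j ≡ adj j i
    irref : ∀ i → adj i i ≡ false
open Graph public

data Reachable {n : ℕ} (G : Graph n) : Fin n → Fin n → Set where
  here : ∀ {a} → Reachable G a a
  step : ∀ {a b c} → adj G a b ≡ true → Reachable G b c → Reachable G a c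

Connected : ∀ {n} → Graph n → Set
Connected {n} G = ∀ (a b : Fin n) → Reachable G a b

-- A graphlet with s nodes: a connected graph H on Fin s together with a
-- designated orbit, given by a representative vertex `root`
-- (the orbit is the set of images of `root` under automorphisms of H).

record Graphlet (s : ℕ) : Set where
  field
    graph     : Graph s
    connected : Connected graph
    root      : Fin s
open Graphlet public

_==ᶠ_ : ∀ {n} → Fin n → Fin n → Bool
i ==ᶠ j = does (i F.≟ j)

_==ᵇ_ : Bool → Bool → Bool
a ==ᵇ b = does (a B.≟ b)

allVecs : ∀ {A : Set} → List A → (s : ℕ) → List (Vec A s)
allVecs xs zero    = [ [] ]
allVecs xs (suc s) = concatMap (λ x → map (x ∷_) (allVecs xs s)) xs

allMaps : (s n : ℕ) → List (Vec (Fin n) s)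
allMaps s n = allVecs (allFin n) s

allSubsets : (n : ℕ) → List (Vec Bool n)
allSubsets n = allVecs (true ∷ false ∷ []) n

isEmbedding : ∀ {s n} → Graph s → Graph n → (Fin s → Fin n) → Bool
isEmbedding {s} H G φ =
  all (λ a → all (λ b →
        (not (φ a ==ᶠ φ b) ∨ (a ==ᶠ b)) ∧ (adj H a b ==ᵇ adj G (φ a) (φ b)))
      (allFin s)) (allFin s)

hasImage : ∀ {s n} → (Fin s → Fin n) → Vec Bool n → Bool
hasImage {s} {n} φ S =
  all (λ x → lookup S x ==ᵇ any (λ a → φ a ==ᶠ x) (allFin s)) (allFin n)

-- automorphisms of H: induced embeddings H → H (bijective as injective
-- self-maps of a finite set)
isAutomorphism : ∀ {s} → Graph s → (Fin s → Fin s) → Bool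
isAutomorphism H α = isEmbedding H H α

inOrbit : ∀ {s} → Graph s → Fin s → Fin s → Bool
inOrbit {s} H rt u =
  any (λ α → isAutomorphism H (lookup α) ∧ (lookup α rt ==ᶠ u)) (allMaps s s)

isOccurrence : ∀ {s n} → Graphlet s → Graph n → Fin n → Vec Bool n → Bool
isOccurrence {s} {n} Hσ G v S =
  any (λ φ → isEmbedding (graph Hσ) G (lookup φ) ∧ hasImage (lookup φ) S
           ∧ any (λ u → inOrbit (graph Hσ) (root Hσ) u ∧ (lookup φ u ==ᶠ v))
                 (allFin s))
      (allMaps s n)

-- net count f(H_σ | G)(v): number of distinct induced subgraphs (vertex sets)
netCount : ∀ {s n} → Graphlet s → Graph n → Fin n → ℕ
netCount Hσ G v = length (filter (λ S → isOccurrence Hσ G v S B.≟ true) (allSubsets _))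

-- W_{r,s}(i,j) = f(H_i | H_j)(v') with v' in the designated orbit of H_j
-- (H_j regarded as a source graph); we take v' = root of H_j.
W : ∀ {r s} → Graphlet r → Graphlet s → ℕ
W Hi Hj = netCount Hi (graph Hj) (root Hj)

-- An occurrence of H_j at v yields, after composing with an automorphism of
-- H_j, an induced embedding ψ : H_j → G with ψ(root) = v. Pushing subsets of
-- V(H_j) forward along ψ sends the occurrences of H_i at the root of H_j
-- injectively to occurrences of H_i at v, so W(i,j) ≤ f(H_i | G)(v). Hence
-- f(H_i | G)(v) < W(i,j) leaves no occurrence of H_j at v.

module Submission where

open import Defs hiding (sym)
open import Data.Bool using (Bool; true; false; T; not; _∧_; _∨_)
import Data.Bool as Bool
open import Data.Bool.ListAction using (all; any)
open import Data.Bool.Properties using (T-∧; T-≡)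
open import Data.Empty using (⊥-elim)
open import Data.Fin using (Fin)
import Data.Fin as Fin
open import Data.List using (List; []; _∷_; map; filter; length; allFin; cartesianProductWith; _++_; concatMap)
open import Data.List.Properties using (length-map; length-removeAt′; filter-none)
open import Data.List.Relation.Unary.Any using (here; there)
open import Data.List.Relation.Unary.Any.Properties using (any⇔)
import Data.List.Relation.Unary.All as All
open import Data.List.Relation.Unary.All.Properties using (all⁺; all⁻)
open import Data.List.Relation.Unary.AllPairs using ([]; _∷_)
open import Data.List.Membership.Propositional using (_∈_; _─_; find; lose)
open import Data.List.Membership.Propositional.Properties
  using (∈-allFin; ∈-filter⁺; ∈-filter⁻; ∈-map⁻; ∈-cartesianProductWith⁺)
open import Data.List.Relation.Unary.Unique.Propositional using (Unique)
import Data.List.Relation.Unary.Unique.Propositional.Properties as Unique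
open import Data.Nat using (ℕ; zero; suc; _<_; _≤_; z≤n; s≤s)
open import Data.Nat.Properties using (<⇒≱; module ≤-Reasoning)
open import Data.Product using (∃; _×_; _,_; proj₁; proj₂)
open import Data.Vec using (Vec; []; _∷_; lookup; tabulate)
open import Data.Vec.Properties using (lookup∘tabulate; tabulate∘lookup; tabulate-cong)
open import Function using (_∘_; const)
open import Function.Bundles using (_⇔_; mk⇔; module Equivalence)
open import Function.Properties.Equivalence using () renaming (trans to ⇔-trans; sym to ⇔-sym)
open import Relation.Nullary using (Dec; yes; no; does; ¬_)
open import Relation.Binary.PropositionalEquality
  using (_≡_; _≢_; refl; sym; trans; cong; cong₂; subst; _≗_; module ≡-Reasoning)

open Equivalence using (to; from)

private
  variable
    r s n : ℕ

T-does : ∀ {a} {A : Set a} (d : Dec A) → T (does d) ⇔ A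
T-does (yes a) = mk⇔ (const a) (const _)
T-does (no ¬a) = mk⇔ (λ ()) ¬a

T-==ᶠ : {i j : Fin n} → T (i ==ᶠ j) ⇔ i ≡ j
T-==ᶠ {i = i} {j} = T-does (i Fin.≟ j)

T-==ᵇ : {a b : Bool} → T (a ==ᵇ b) ⇔ a ≡ b
T-==ᵇ {a} {b} = T-does (a Bool.≟ b)

T-not-∨ : {a b : Bool} → T (not a ∨ b) ⇔ (T a → T b)
T-not-∨ {true}  {true}  = mk⇔ const (const _)
T-not-∨ {true}  {false} = mk⇔ (λ ()) (λ f → f _)
T-not-∨ {false}         = mk⇔ (λ _ ()) (const _)

≡⇔T⇔T : {a b : Bool} → a ≡ b ⇔ (T a ⇔ T b)
≡⇔T⇔T {true}  {true}  = mk⇔ (const (mk⇔ (const _) (const _))) (const refl)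
≡⇔T⇔T {false} {false} = mk⇔ (const (mk⇔ (λ ()) (λ ()))) (const refl)
≡⇔T⇔T {true}  {false} = mk⇔ (λ ()) (λ e → ⊥-elim (to e _))
≡⇔T⇔T {false} {true}  = mk⇔ (λ ()) (λ e → ⊥-elim (from e _))

T-any : ∀ {A : Set} (p : A → Bool) (xs : List A) → T (any p xs) ⇔ (∃ λ x → x ∈ xs × T (p x))
T-any p xs = mk⇔ (find ∘ from any⇔) (λ (_ , x∈xs , px) → to any⇔ (lose x∈xs px))

T-any-allFin : (p : Fin n → Bool) → T (any p (allFin n)) ⇔ (∃ λ x → T (p x))
T-any-allFin {n} p = mk⇔ (λ t → let x , _ , px = to (T-any p (allFin n)) t in x , px)
                     (λ (x , px) → from (T-any p (allFin n)) (x , ∈-allFin x , px))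

T-all-allFin : (p : Fin n → Bool) → T (all p (allFin n)) ⇔ (∀ x → T (p x))
T-all-allFin p = mk⇔ (λ t x → All.lookup (all⁺ p (allFin _) t) (∈-allFin x))
                     (λ f → all⁻ p {allFin _} (All.tabulate (λ {x} _ → f x)))

vec-ext : ∀ {A : Set} {u w : Vec A n} → (∀ i → lookup u i ≡ lookup w i) → u ≡ w
vec-ext {u = u} {w} eq = begin
  u                   ≡⟨ sym (tabulate∘lookup u) ⟩
  tabulate (lookup u) ≡⟨ tabulate-cong eq ⟩
  tabulate (lookup w) ≡⟨ tabulate∘lookup w ⟩
  w                   ∎
  where open ≡-Reasoning

∈-─ : ∀ {A : Set} {x y : A} {ys : List A} (x∈ys : x ∈ ys) → y ∈ ys → x ≢ y → y ∈ ys ─ x∈ys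
∈-─ (here refl) (here refl) x≢y = ⊥-elim (x≢y refl)
∈-─ (here _)    (there y∈ys) _  = y∈ys
∈-─ (there _)   (here y≡z)   _  = here y≡z
∈-─ (there x∈ys) (there y∈ys) x≢y = there (∈-─ x∈ys y∈ys x≢y)

Unique⇒length≤ : ∀ {A : Set} {xs ys : List A} → Unique xs → (∀ {x} → x ∈ xs → x ∈ ys) → length xs ≤ length ys
Unique⇒length≤ {xs = []} _ _ = z≤n
Unique⇒length≤ {xs = x ∷ xs} {ys} (x≢xs ∷ unique) xs⊆ys = begin
  suc (length xs)          ≤⟨ s≤s (Unique⇒length≤ unique (λ y∈xs →
                                ∈-─ x∈ys (xs⊆ys (there y∈xs)) (All.lookup x≢xs y∈xs))) ⟩
  suc (length (ys ─ x∈ys)) ≡⟨ sym (length-removeAt′ ys _) ⟩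
  length ys                ∎
  where
  open ≤-Reasoning
  x∈ys = xs⊆ys (here refl)

allVecs-suc : ∀ {A : Set} (xs : List A) s → allVecs xs (suc s) ≡ cartesianProductWith _∷_ xs (allVecs xs s)
allVecs-suc xs s = go xs
  where
  go : ∀ ys → concatMap (λ x → map (x ∷_) (allVecs xs s)) ys ≡ cartesianProductWith _∷_ ys (allVecs xs s)
  go []       = refl
  go (y ∷ ys) = cong (map (y ∷_) (allVecs xs s) ++_) (go ys)

∈-allVecs : ∀ {A : Set} (xs : List A) s (v : Vec A s) → (∀ i → lookup v i ∈ xs) → v ∈ allVecs xs s
∈-allVecs xs zero    []      _  = here refl
∈-allVecs xs (suc s) (x ∷ v) v⊆xs = subst (x ∷ v ∈_) (sym (allVecs-suc xs s))
  (∈-cartesianProductWith⁺ _∷_ (v⊆xs Fin.zero) (∈-allVecs xs s v (v⊆xs ∘ Fin.suc)))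

allVecs-unique : ∀ {A : Set} {xs : List A} → Unique xs → ∀ s → Unique (allVecs xs s)
allVecs-unique _      zero    = All.[] ∷ []
allVecs-unique {xs = xs} unique (suc s) = subst Unique (sym (allVecs-suc xs s))
  (Unique.cartesianProductWith⁺ _∷_ ∷-injective unique (allVecs-unique unique s))
  where
  ∷-injective : ∀ {A : Set} {k} {w x : A} {y z : Vec A k} → w ∷ y ≡ x ∷ z → w ≡ x × y ≡ z
  ∷-injective refl = refl , refl

∈-allMaps : (φ : Vec (Fin n) s) → φ ∈ allMaps s n
∈-allMaps φ = ∈-allVecs _ _ φ (∈-allFin ∘ lookup φ)

∈-allSubsets : (S : Vec Bool n) → S ∈ allSubsets n
∈-allSubsets S = ∈-allVecs _ _ S (λ i → ∈-Bool (lookup S i))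
  where
  ∈-Bool : (b : Bool) → b ∈ true ∷ false ∷ []
  ∈-Bool true  = here refl
  ∈-Bool false = there (here refl)

allSubsets-unique : Unique (allSubsets n)
allSubsets-unique = allVecs-unique (((λ ()) All.∷ All.[]) ∷ All.[] ∷ []) _

record IsInducedEmbedding (H : Graph s) (G : Graph n) (φ : Fin s → Fin n) : Set where
  field
    injective     : ∀ {a b} → φ a ≡ φ b → a ≡ b
    preserves-adj : ∀ a b → adj H a b ≡ adj G (φ a) (φ b)
open IsInducedEmbedding

T-isEmbedding : {H : Graph s} {G : Graph n} {φ : Fin s → Fin n} → T (isEmbedding H G φ) ⇔ IsInducedEmbedding H G φ
T-isEmbedding {s} {H = H} {G} {φ} = mk⇔ sound complete
  where
  injective-at : Fin s → Fin s → Bool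
  injective-at a b = not (φ a ==ᶠ φ b) ∨ (a ==ᶠ b)

  adj-at : Fin s → Fin s → Bool
  adj-at a b = adj H a b ==ᵇ adj G (φ a) (φ b)

  T-at : ∀ a b → T (injective-at a b ∧ adj-at a b) ⇔ (T (injective-at a b) × T (adj-at a b))
  T-at a b = T-∧ {injective-at a b}

  T-all : T (isEmbedding H G φ) ⇔ (∀ a b → T (injective-at a b ∧ adj-at a b))
  T-all = mk⇔ (λ t a → to (T-all-allFin _) (to (T-all-allFin row) t a))
              (λ f → from (T-all-allFin row) (λ a → from (T-all-allFin _) (f a)))
    where
    row : Fin s → Bool
    row a = all (λ b → injective-at a b ∧ adj-at a b) (allFin s)

  sound : T (isEmbedding H G φ) → IsInducedEmbedding H G φ
  sound t = record
    { injective     = λ {a} {b} → to T-==ᶠ ∘ to T-not-∨ (proj₁ (at a b)) ∘ from T-==ᶠ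
    ; preserves-adj = λ a b → to T-==ᵇ (proj₂ (at a b))
    }
    where
    at : ∀ a b → T (injective-at a b) × T (adj-at a b)
    at a b = to (T-at a b) (to T-all t a b)

  complete : IsInducedEmbedding H G φ → T (isEmbedding H G φ)
  complete emb = from T-all λ a b → from (T-at a b)
    ( from T-not-∨ (from T-==ᶠ ∘ injective emb ∘ to T-==ᶠ)
    , from T-==ᵇ (preserves-adj emb a b)
    )

isInducedEmbedding-∘ : {K : Graph r} {H : Graph s} {G : Graph n} {ψ : Fin s → Fin n} {χ : Fin r → Fin s}
  → IsInducedEmbedding H G ψ → IsInducedEmbedding K H χ → IsInducedEmbedding K G (ψ ∘ χ)
isInducedEmbedding-∘ ψ-emb χ-emb = record
  { injective     = injective χ-emb ∘ injective ψ-emb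
  ; preserves-adj = λ a b → trans (preserves-adj χ-emb a b) (preserves-adj ψ-emb _ _)
  }

isInducedEmbedding-resp-≗ : {H : Graph s} {G : Graph n} {φ φ′ : Fin s → Fin n}
  → φ ≗ φ′ → IsInducedEmbedding H G φ → IsInducedEmbedding H G φ′
isInducedEmbedding-resp-≗ {G = G} φ≗φ′ emb = record
  { injective     = λ {a} {b} e → injective emb (trans (φ≗φ′ a) (trans e (sym (φ≗φ′ b))))
  ; preserves-adj = λ a b → trans (preserves-adj emb a b) (cong₂ (adj G) (φ≗φ′ a) (φ≗φ′ b))
  }

inOrbit⇒automorphism : {H : Graph s} {ρ u : Fin s} → T (inOrbit H ρ u)
  → ∃ λ α → IsInducedEmbedding H H α × α ρ ≡ u
inOrbit⇒automorphism {s} {H} {ρ} {u} t =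
  let αv , _ , automorphic = to (T-any (λ α → isAutomorphism H (lookup α) ∧ (lookup α ρ ==ᶠ u)) (allMaps s s)) t
      isAut , αρ≡u = to (T-∧ {isAutomorphism H (lookup αv)}) automorphic
  in lookup αv , to T-isEmbedding isAut , to T-==ᶠ αρ≡u

IsImage : (Fin s → Fin n) → Vec Bool n → Set
IsImage φ S = ∀ x → T (lookup S x) ⇔ (∃ λ a → φ a ≡ x)

isImage-resp-≗ : {φ φ′ : Fin s → Fin n} {S : Vec Bool n} → φ ≗ φ′ → IsImage φ S → IsImage φ′ S
isImage-resp-≗ φ≗φ′ img x = ⇔-trans (img x)
  (mk⇔ (λ (a , φa≡x) → a , trans (sym (φ≗φ′ a)) φa≡x) (λ (a , φ′a≡x) → a , trans (φ≗φ′ a) φ′a≡x))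

T-hasImage : (φ : Fin s → Fin n) (S : Vec Bool n) → T (hasImage φ S) ⇔ IsImage φ S
T-hasImage {s} {n} φ S = mk⇔
  (λ t x → ⇔-trans (to ≡⇔T⇔T (to T-==ᵇ (to (T-all-allFin agrees) t x))) (T-hit x))
  (λ img → from (T-all-allFin agrees) λ x → from T-==ᵇ (from ≡⇔T⇔T (⇔-trans (img x) (⇔-sym (T-hit x)))))
  where
  hit : Fin n → Bool
  hit x = any (λ a → φ a ==ᶠ x) (allFin s)

  agrees : Fin n → Bool
  agrees x = lookup S x ==ᵇ hit x

  T-hit : ∀ x → T (hit x) ⇔ (∃ λ a → φ a ≡ x)
  T-hit x = mk⇔ (λ t → let a , φa==x = to (T-any-allFin _) t in a , to T-==ᶠ φa==x)
                (λ (a , φa≡x) → from (T-any-allFin (λ a → φ a ==ᶠ x)) (a , from T-==ᶠ φa≡x))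

image : (Fin s → Fin n) → Vec Bool s → Vec Bool n
image {s} ψ S = tabulate λ x → any (λ a → lookup S a ∧ (ψ a ==ᶠ x)) (allFin s)

T-lookup-image : (ψ : Fin s → Fin n) (S : Vec Bool s) (x : Fin n)
  → T (lookup (image ψ S) x) ⇔ (∃ λ a → T (lookup S a) × ψ a ≡ x)
T-lookup-image {s} ψ S x = ⇔-trans (mk⇔ (subst T lookup-x) (subst T (sym lookup-x))) (mk⇔
  (λ t → let a , hit = to (T-any-allFin covers) t
             Sa , ψa==x = to (T-∧ {lookup S a}) hit
         in a , Sa , to T-==ᶠ ψa==x)
  (λ (a , Sa , ψa≡x) → from (T-any-allFin covers) (a , from (T-∧ {lookup S a}) (Sa , from T-==ᶠ ψa≡x))))
  where
  covers : Fin s → Bool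
  covers a = lookup S a ∧ (ψ a ==ᶠ x)

  lookup-x : lookup (image ψ S) x ≡ any covers (allFin s)
  lookup-x = lookup∘tabulate _ x

image-isImage-∘ : {ψ : Fin s → Fin n} {χ : Fin r → Fin s} {S : Vec Bool s}
  → IsImage χ S → IsImage (ψ ∘ χ) (image ψ S)
image-isImage-∘ {ψ = ψ} {χ} {S} img x = ⇔-trans (T-lookup-image ψ S x) (mk⇔
  (λ (a , Sa , ψa≡x) → let b , χb≡a = to (img a) Sa in b , trans (cong ψ χb≡a) ψa≡x)
  (λ (b , ψχb≡x) → χ b , from (img (χ b)) (b , refl) , ψχb≡x))

image-injective : {ψ : Fin s → Fin n} → (∀ {a b} → ψ a ≡ ψ b → a ≡ b)
  → {S S′ : Vec Bool s} → image ψ S ≡ image ψ S′ → S ≡ S′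
image-injective {ψ = ψ} ψ-injective {S} {S′} eq =
  vec-ext λ a → from ≡⇔T⇔T (mk⇔ (transport {S} {S′} eq a) (transport {S′} {S} (sym eq) a))
  where
  transport : ∀ {S S′} → image ψ S ≡ image ψ S′ → ∀ a → T (lookup S a) → T (lookup S′ a)
  transport {S} {S′} eq a Sa =
    let a′ , S′a′ , ψa′≡ψa = to (T-lookup-image ψ S′ (ψ a))
                               (subst (λ U → T (lookup U (ψ a))) eq (from (T-lookup-image ψ S (ψ a)) (a , Sa , refl)))
    in subst (T ∘ lookup S′) (ψ-injective ψa′≡ψa) S′a′

record Occurrence (Hσ : Graphlet s) (G : Graph n) (v : Fin n) (S : Vec Bool n) : Set where
  field
    φ           : Fin s → Fin n
    embedding   : IsInducedEmbedding (graph Hσ) G φ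
    φ-image     : IsImage φ S
    point       : Fin s
    point∈orbit : T (inOrbit (graph Hσ) (root Hσ) point)
    φ-point≡v   : φ point ≡ v
open Occurrence

T-isOccurrence : (Hσ : Graphlet s) (G : Graph n) (v : Fin n) (S : Vec Bool n)
  → T (isOccurrence Hσ G v S) ⇔ Occurrence Hσ G v S
T-isOccurrence {s} {n} Hσ G v S = mk⇔ sound complete
  where
  H : Graph s
  H = graph Hσ

  rooted : Vec (Fin n) s → Bool
  rooted φ = any (λ u → inOrbit H (root Hσ) u ∧ (lookup φ u ==ᶠ v)) (allFin s)

  witnesses : Vec (Fin n) s → Bool
  witnesses φ = isEmbedding H G (lookup φ) ∧ hasImage (lookup φ) S ∧ rooted φ

  sound : T (isOccurrence Hσ G v S) → Occurrence Hσ G v S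
  sound t =
    let φ , _ , wφ        = to (T-any witnesses (allMaps s n)) t
        emb , rest        = to (T-∧ {isEmbedding H G (lookup φ)}) wφ
        img , rφ          = to (T-∧ {hasImage (lookup φ) S}) rest
        u , hit           = to (T-any-allFin _) rφ
        u∈orbit , φu==v   = to (T-∧ {inOrbit H (root Hσ) u}) hit
    in record
      { φ = lookup φ ; embedding = to T-isEmbedding emb ; φ-image = to (T-hasImage (lookup φ) S) img
      ; point = u ; point∈orbit = u∈orbit ; φ-point≡v = to T-==ᶠ φu==v
      }

  complete : Occurrence Hσ G v S → T (isOccurrence Hσ G v S)
  complete occ = from (T-any witnesses (allMaps s n)) (table , ∈-allMaps table ,
    from T-∧ (from T-isEmbedding (isInducedEmbedding-resp-≗ φ≗table (embedding occ)) ,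
    from T-∧ (from (T-hasImage (lookup table) S) (isImage-resp-≗ {S = S} φ≗table (φ-image occ)) ,
    from (T-any-allFin _) (point occ , from T-∧ (point∈orbit occ ,
      from T-==ᶠ (trans (sym (φ≗table (point occ))) (φ-point≡v occ)))))))
    where
    table : Vec (Fin n) s
    table = tabulate (φ occ)

    φ≗table : φ occ ≗ lookup table
    φ≗table a = sym (lookup∘tabulate (φ occ) a)

occurrence⇒rootedEmbedding : {Hσ : Graphlet s} {G : Graph n} {v : Fin n} {S : Vec Bool n}
  → Occurrence Hσ G v S → ∃ λ ψ → IsInducedEmbedding (graph Hσ) G ψ × ψ (root Hσ) ≡ v
occurrence⇒rootedEmbedding occ =
  let α , α-automorphism , αρ≡u = inOrbit⇒automorphism (point∈orbit occ)
  in φ occ ∘ α , isInducedEmbedding-∘ (embedding occ) α-automorphism , trans (cong (φ occ) αρ≡u) (φ-point≡v occ)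

occurrence-pushforward : {Hσ : Graphlet r} {H : Graph s} {G : Graph n} {ψ : Fin s → Fin n} {w : Fin s} {v : Fin n}
  → IsInducedEmbedding H G ψ → ψ w ≡ v → {S : Vec Bool s} → Occurrence Hσ H w S → Occurrence Hσ G v (image ψ S)
occurrence-pushforward {ψ = ψ} ψ-embedding ψw≡v {S} occ = record
  { φ           = ψ ∘ φ occ
  ; embedding   = isInducedEmbedding-∘ ψ-embedding (embedding occ)
  ; φ-image     = image-isImage-∘ {ψ = ψ} {S = S} (φ-image occ)
  ; point       = point occ
  ; point∈orbit = point∈orbit occ
  ; φ-point≡v   = trans (cong ψ (φ-point≡v occ)) ψw≡v
  }

isOccurrence? : (Hσ : Graphlet s) (G : Graph n) (v : Fin n) (S : Vec Bool n) → Dec (isOccurrence Hσ G v S ≡ true)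
isOccurrence? Hσ G v S = isOccurrence Hσ G v S Bool.≟ true

occurrences : Graphlet s → Graph n → Fin n → List (Vec Bool n)
occurrences Hσ G v = filter (isOccurrence? Hσ G v) (allSubsets _)

∈-occurrences : (Hσ : Graphlet s) (G : Graph n) (v : Fin n) {S : Vec Bool n}
  → S ∈ occurrences Hσ G v ⇔ Occurrence Hσ G v S
∈-occurrences {n = n} Hσ G v {S} = mk⇔
  (λ S∈ → to (T-isOccurrence Hσ G v S) (from T-≡ (proj₂ (∈-filter⁻ (isOccurrence? Hσ G v) {xs = allSubsets n} S∈))))
  (λ occ → ∈-filter⁺ (isOccurrence? Hσ G v) (∈-allSubsets S) (to T-≡ (from (T-isOccurrence Hσ G v S) occ)))

netCount≡0 : (Hσ : Graphlet s) (G : Graph n) (v : Fin n) → (∀ {S} → ¬ Occurrence Hσ G v S) → netCount Hσ G v ≡ 0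
netCount≡0 {n = n} Hσ G v no-occurrence = cong length (filter-none (isOccurrence? Hσ G v) {allSubsets n}
  (All.tabulate λ {S} _ isOcc → no-occurrence (to (T-isOccurrence Hσ G v S) (from T-≡ isOcc))))

netCount-mono : (Hσ : Graphlet r) {H : Graph s} {G : Graph n} {ψ : Fin s → Fin n} {w : Fin s} {v : Fin n}
  → IsInducedEmbedding H G ψ → ψ w ≡ v → netCount Hσ H w ≤ netCount Hσ G v
netCount-mono Hσ {H} {G} {ψ} {w} {v} ψ-embedding ψw≡v = begin
  length (occurrences Hσ H w)                 ≡⟨ sym (length-map (image ψ) (occurrences Hσ H w)) ⟩
  length (map (image ψ) (occurrences Hσ H w)) ≤⟨ Unique⇒length≤ pushed-unique pushed⊆ ⟩
  length (occurrences Hσ G v)                 ∎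
  where
  open ≤-Reasoning

  pushed-unique : Unique (map (image ψ) (occurrences Hσ H w))
  pushed-unique = Unique.map⁺ (image-injective (injective ψ-embedding)) (Unique.filter⁺ _ allSubsets-unique)

  pushed⊆ : ∀ {U} → U ∈ map (image ψ) (occurrences Hσ H w) → U ∈ occurrences Hσ G v
  pushed⊆ U∈ with S , S∈ , refl ← ∈-map⁻ (image ψ) U∈ =
    from (∈-occurrences Hσ G v) (occurrence-pushforward ψ-embedding ψw≡v (to (∈-occurrences Hσ H w) S∈))

proposition2 : ∀ {n : ℕ} (G : Graph n) (s : ℕ) → 1 < s → (Hj : Graphlet s) → (v : Fin n)
    → (r : ℕ) → r < s → (Hi : Graphlet r)
    → netCount Hi G v < W Hi Hj → netCount Hj G v ≡ 0
proposition2 G _ _ Hj v _ _ Hi count<W = netCount≡0 Hj G v λ occ →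
  let ψ , ψ-embedding , ψρ≡v = occurrence⇒rootedEmbedding occ
  in <⇒≱ count<W (netCount-mono Hi ψ-embedding ψρ≡v)
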